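{- Let $a,b,c$ be positive integers such that $b\mid ac$ and $b^2\mid (ab+bc+ca)$. Then the lens sequence extended from the seed $(a,b,c)$ consists of integers.
   Context: Given a seed $(a,b,c)$ of real numbers with $b\neq0$, the lens sequence extended from it is the bilateral sequence $(b_n)_{n\in\mathbb Z}$ with $b_0=a$, $b_1=b$, satisfying $b_n=\alpha b_{n-1}-b_{n-2}+\beta$ for all $n\in\mathbb Z$ (applied forwards and backwards), where $\alpha=\frac{ab+bc+ca}{b^2}-1$ and $\beta=\frac{b^2-ac}{b}$; then $b_2=c$. -}

module Defs where

open import Data.Nat as ℕ using (ℕ)
open import Data.Integer as ℤ using (ℤ; +_)
open import Data.Rational using (ℚ; mkℚ+; _+_; _*_; _-_; _÷_; 1ℚ; NonZero)
open import Data.Nat.Coprimality using (1-coprimeTo) renaming (sym to coprime-sym)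
open import Data.Product using (_×_)
open import Relation.Binary.PropositionalEquality using (_≡_)

ℕ→ℚ : ℕ → ℚ
ℕ→ℚ n = mkℚ+ n 1 (coprime-sym (1-coprimeTo n))

lensα : (a b c : ℚ) → .{{_ : NonZero b}} → ℚ
lensα a b c = (((a * b + b * c + c * a) ÷ b) ÷ b) - 1ℚ

lensβ : (a b c : ℚ) → .{{_ : NonZero b}} → ℚ
lensβ a b c = (b * b - a * c) ÷ b

IsLensSequence : (a b c : ℚ) → .{{_ : NonZero b}} → (ℤ → ℚ) → Set
IsLensSequence a b c s =
  (s (+ 0) ≡ a) × (s (+ 1) ≡ b) ×
  ((n : ℤ) → s n ≡ lensα a b c * s (n ℤ.- + 1) - s (n ℤ.- + 2) + lensβ a b c)

-- With q = (ab + bc + ca)/b² and r = ac/b, the recurrence reads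
-- s n = (q - 1) s(n-1) - s(n-2) + (b - r), whose coefficients are integers. As the
-- coefficient of s(n-2) is -1, the recurrence can be solved for s(n-2) as well as for
-- s n, so integrality of two consecutive terms propagates in both directions from
-- s 0 = a, s 1 = b.
{-# OPTIONS --safe #-}
module Submission where

open import Defs
open import Data.Nat as ℕ using (ℕ; _*_; _+_; NonZero)
open import Data.Nat.Divisibility using (_∣_; divides)
import Data.Nat.Properties as ℕ
open import Data.Integer as ℤ using (ℤ; +_; -[1+_]; 0ℤ; 1ℤ)
import Data.Integer.Properties as ℤ
open import Data.Integer.Tactic.RingSolver using (solve-∀)
open import Data.Rational as ℚ using (ℚ; _/_; toℚᵘ; 1ℚ; _÷_)
import Data.Rational.Properties as ℚ
open import Data.Rational.Solver using (module +-*-Solver)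
import Data.Rational.Unnormalised as ℚᵘ
import Data.Rational.Unnormalised.Properties as ℚᵘ
open import Data.Product using (∃; _,_; _×_; proj₁)
open import Relation.Binary.PropositionalEquality

ℤ-bi-induction : ∀ {p} (P : ℤ → Set p) → P 0ℤ →
  (∀ i → P i → P (ℤ.suc i)) → (∀ i → P (ℤ.suc i) → P i) → ∀ i → P i
ℤ-bi-induction P P0 up down (+ ℕ.zero)  = P0
ℤ-bi-induction P P0 up down (+ ℕ.suc n) = up (+ n) (ℤ-bi-induction P P0 up down (+ n))
ℤ-bi-induction P P0 up down -[1+ ℕ.zero ]  = down -[1+ 0 ] P0
ℤ-bi-induction P P0 up down -[1+ ℕ.suc n ] =
  down -[1+ ℕ.suc n ] (ℤ-bi-induction P P0 up down -[1+ n ])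

ℤ→ℚ : ℤ → ℚ
ℤ→ℚ k = k / 1

toℚᵘ-ℤ→ℚ : ∀ k → toℚᵘ (ℤ→ℚ k) ℚᵘ.≃ ℚᵘ.mkℚᵘ k 0
toℚᵘ-ℤ→ℚ k = ℚ.toℚᵘ-fromℚᵘ (ℚᵘ.mkℚᵘ k 0)

ℤ→ℚ-homo-+ : ∀ k m → ℤ→ℚ (k ℤ.+ m) ≡ ℤ→ℚ k ℚ.+ ℤ→ℚ m
ℤ→ℚ-homo-+ k m = ℚ.toℚᵘ-injective (ℚᵘ.≃-sym (begin
  toℚᵘ (ℤ→ℚ k ℚ.+ ℤ→ℚ m)               ≈⟨ ℚ.toℚᵘ-homo-+ (ℤ→ℚ k) (ℤ→ℚ m) ⟩
  toℚᵘ (ℤ→ℚ k) ℚᵘ.+ toℚᵘ (ℤ→ℚ m)       ≈⟨ ℚᵘ.+-cong (toℚᵘ-ℤ→ℚ k) (toℚᵘ-ℤ→ℚ m) ⟩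
  ℚᵘ.mkℚᵘ k 0 ℚᵘ.+ ℚᵘ.mkℚᵘ m 0         ≈⟨ ℚᵘ.*≡* (cross-+ k m) ⟩
  ℚᵘ.mkℚᵘ (k ℤ.+ m) 0                   ≈⟨ toℚᵘ-ℤ→ℚ (k ℤ.+ m) ⟨
  toℚᵘ (ℤ→ℚ (k ℤ.+ m))                  ∎))
  where
  open ℚᵘ.≃-Reasoning
  cross-+ : ∀ k m → (k ℤ.* 1ℤ ℤ.+ m ℤ.* 1ℤ) ℤ.* 1ℤ ≡ (k ℤ.+ m) ℤ.* (1ℤ ℤ.* 1ℤ)
  cross-+ = solve-∀

ℤ→ℚ-homo-* : ∀ k m → ℤ→ℚ (k ℤ.* m) ≡ ℤ→ℚ k ℚ.* ℤ→ℚ m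
ℤ→ℚ-homo-* k m = ℚ.toℚᵘ-injective (ℚᵘ.≃-sym (begin
  toℚᵘ (ℤ→ℚ k ℚ.* ℤ→ℚ m)               ≈⟨ ℚ.toℚᵘ-homo-* (ℤ→ℚ k) (ℤ→ℚ m) ⟩
  toℚᵘ (ℤ→ℚ k) ℚᵘ.* toℚᵘ (ℤ→ℚ m)       ≈⟨ ℚᵘ.*-cong (toℚᵘ-ℤ→ℚ k) (toℚᵘ-ℤ→ℚ m) ⟩
  ℚᵘ.mkℚᵘ k 0 ℚᵘ.* ℚᵘ.mkℚᵘ m 0         ≈⟨ ℚᵘ.*≡* (cross-* k m) ⟩
  ℚᵘ.mkℚᵘ (k ℤ.* m) 0                   ≈⟨ toℚᵘ-ℤ→ℚ (k ℤ.* m) ⟨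
  toℚᵘ (ℤ→ℚ (k ℤ.* m))                  ∎))
  where
  open ℚᵘ.≃-Reasoning
  cross-* : ∀ k m → (k ℤ.* m) ℤ.* 1ℤ ≡ (k ℤ.* m) ℤ.* (1ℤ ℤ.* 1ℤ)
  cross-* = solve-∀

ℤ→ℚ-homo‿- : ∀ k → ℤ→ℚ (ℤ.- k) ≡ ℚ.- ℤ→ℚ k
ℤ→ℚ-homo‿- k = ℚ.toℚᵘ-injective (ℚᵘ.≃-sym (begin
  toℚᵘ (ℚ.- ℤ→ℚ k)      ≈⟨ ℚ.toℚᵘ-homo‿- (ℤ→ℚ k) ⟩
  ℚᵘ.- toℚᵘ (ℤ→ℚ k)     ≈⟨ ℚᵘ.-‿cong (toℚᵘ-ℤ→ℚ k) ⟩
  ℚᵘ.mkℚᵘ (ℤ.- k) 0     ≈⟨ toℚᵘ-ℤ→ℚ (ℤ.- k) ⟨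
  toℚᵘ (ℤ→ℚ (ℤ.- k))    ∎))
  where open ℚᵘ.≃-Reasoning

ℕ→ℚ≡ℤ→ℚ : ∀ n → ℕ→ℚ n ≡ ℤ→ℚ (+ n)
ℕ→ℚ≡ℤ→ℚ n = ℚ.toℚᵘ-injective (ℚᵘ.≃-sym (toℚᵘ-ℤ→ℚ (+ n)))

ℕ→ℚ-homo-+ : ∀ m n → ℕ→ℚ (m + n) ≡ ℕ→ℚ m ℚ.+ ℕ→ℚ n
ℕ→ℚ-homo-+ m n = begin
  ℕ→ℚ (m + n)              ≡⟨ ℕ→ℚ≡ℤ→ℚ (m + n) ⟩
  ℤ→ℚ (+ (m + n))          ≡⟨ cong ℤ→ℚ (ℤ.pos-+ m n) ⟩
  ℤ→ℚ (+ m ℤ.+ + n)        ≡⟨ ℤ→ℚ-homo-+ (+ m) (+ n) ⟩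
  ℤ→ℚ (+ m) ℚ.+ ℤ→ℚ (+ n)  ≡⟨ cong₂ ℚ._+_ (ℕ→ℚ≡ℤ→ℚ m) (ℕ→ℚ≡ℤ→ℚ n) ⟨
  ℕ→ℚ m ℚ.+ ℕ→ℚ n          ∎
  where open ≡-Reasoning

ℕ→ℚ-homo-* : ∀ m n → ℕ→ℚ (m * n) ≡ ℕ→ℚ m ℚ.* ℕ→ℚ n
ℕ→ℚ-homo-* m n = begin
  ℕ→ℚ (m * n)              ≡⟨ ℕ→ℚ≡ℤ→ℚ (m * n) ⟩
  ℤ→ℚ (+ (m * n))          ≡⟨ cong ℤ→ℚ (ℤ.pos-* m n) ⟩
  ℤ→ℚ (+ m ℤ.* + n)        ≡⟨ ℤ→ℚ-homo-* (+ m) (+ n) ⟩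
  ℤ→ℚ (+ m) ℚ.* ℤ→ℚ (+ n)  ≡⟨ cong₂ ℚ._*_ (ℕ→ℚ≡ℤ→ℚ m) (ℕ→ℚ≡ℤ→ℚ n) ⟨
  ℕ→ℚ m ℚ.* ℕ→ℚ n          ∎
  where open ≡-Reasoning

IsIntegral : ℚ → Set
IsIntegral x = ∃ λ (k : ℤ) → x ≡ ℤ→ℚ k

ℕ→ℚ-integral : ∀ n → IsIntegral (ℕ→ℚ n)
ℕ→ℚ-integral n = + n , ℕ→ℚ≡ℤ→ℚ n

+-integral : ∀ {x y} → IsIntegral x → IsIntegral y → IsIntegral (x ℚ.+ y)
+-integral (k , refl) (m , refl) = k ℤ.+ m , sym (ℤ→ℚ-homo-+ k m)

*-integral : ∀ {x y} → IsIntegral x → IsIntegral y → IsIntegral (x ℚ.* y)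
*-integral (k , refl) (m , refl) = k ℤ.* m , sym (ℤ→ℚ-homo-* k m)

-‿integral : ∀ {x} → IsIntegral x → IsIntegral (ℚ.- x)
-‿integral (k , refl) = ℤ.- k , sym (ℤ→ℚ-homo‿- k)

-integral : ∀ {x y} → IsIntegral x → IsIntegral y → IsIntegral (x ℚ.- y)
-integral x y = +-integral x (-‿integral y)

x≡u-y+v⇒y≡u-x+v : ∀ {x y : ℚ} u v → x ≡ u ℚ.- y ℚ.+ v → y ≡ u ℚ.- x ℚ.+ v
x≡u-y+v⇒y≡u-x+v {y = y} u v refl =
  solve 3 (λ y u v → y := u :- (u :- y :+ v) :+ v) refl y u v
  where open +-*-Solver

module _ {α β : ℚ} (α-integral : IsIntegral α) (β-integral : IsIntegral β) (s : ℤ → ℚ)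
  (recurrence : ∀ n → s n ≡ α ℚ.* s (n ℤ.- + 1) ℚ.- s (n ℤ.- + 2) ℚ.+ β) where

  private
    suc-suc-1 : ∀ i → (1ℤ ℤ.+ (1ℤ ℤ.+ i)) ℤ.- + 1 ≡ 1ℤ ℤ.+ i
    suc-suc-1 = solve-∀

    suc-suc-2 : ∀ i → (1ℤ ℤ.+ (1ℤ ℤ.+ i)) ℤ.- + 2 ≡ i
    suc-suc-2 = solve-∀

    recurrence-forward : ∀ i → s (ℤ.suc (ℤ.suc i)) ≡ α ℚ.* s (ℤ.suc i) ℚ.- s i ℚ.+ β
    recurrence-forward i = trans (recurrence (ℤ.suc (ℤ.suc i)))
      (cong₂ (λ j k → α ℚ.* s j ℚ.- s k ℚ.+ β) (suc-suc-1 i) (suc-suc-2 i))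

    Consecutive-integral : ℤ → Set
    Consecutive-integral i = IsIntegral (s i) × IsIntegral (s (ℤ.suc i))

    step-up : ∀ i → Consecutive-integral i → Consecutive-integral (ℤ.suc i)
    step-up i (sᵢ , sᵢ₊₁) = sᵢ₊₁ ,
      subst IsIntegral (sym (recurrence-forward i))
        (+-integral (-integral (*-integral α-integral sᵢ₊₁) sᵢ) β-integral)

    step-down : ∀ i → Consecutive-integral (ℤ.suc i) → Consecutive-integral i
    step-down i (sᵢ₊₁ , sᵢ₊₂) =
      subst IsIntegral (sym (x≡u-y+v⇒y≡u-x+v (α ℚ.* s (ℤ.suc i)) β (recurrence-forward i)))
        (+-integral (-integral (*-integral α-integral sᵢ₊₁) sᵢ₊₂) β-integral) ,
      sᵢ₊₁

  recurrence-integral : IsIntegral (s 0ℤ) → IsIntegral (s 1ℤ) → ∀ n → IsIntegral (s n)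
  recurrence-integral s₀ s₁ n =
    proj₁ (ℤ-bi-induction Consecutive-integral (s₀ , s₁) step-up step-down n)

*-÷-cancel : ∀ x y .{{_ : ℚ.NonZero y}} → (x ℚ.* y) ÷ y ≡ x
*-÷-cancel x y = begin
  x ℚ.* y ℚ.* ℚ.1/ y    ≡⟨ ℚ.*-assoc x y (ℚ.1/ y) ⟩
  x ℚ.* (y ℚ.* ℚ.1/ y)  ≡⟨ cong (x ℚ.*_) (ℚ.*-inverseʳ y) ⟩
  x ℚ.* 1ℚ              ≡⟨ ℚ.*-identityʳ x ⟩
  x                     ∎
  where open ≡-Reasoning

module _ (a b c : ℕ) .{{_ : NonZero b}} where

  private
    A B C : ℚ
    A = ℕ→ℚ a
    B = ℕ→ℚ b
    C = ℕ→ℚ c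

  lensα-integral : b * b ∣ a * b + b * c + c * a → IsIntegral (lensα A B C)
  lensα-integral (divides q ab+bc+ca≡q*b*b) =
    subst IsIntegral (sym lensα≡q-1) (-integral (ℕ→ℚ-integral q) (ℕ→ℚ-integral 1))
    where
    open ≡-Reasoning
    Q = ℕ→ℚ q

    numerator : A ℚ.* B ℚ.+ B ℚ.* C ℚ.+ C ℚ.* A ≡ Q ℚ.* B ℚ.* B
    numerator = begin
      A ℚ.* B ℚ.+ B ℚ.* C ℚ.+ C ℚ.* A
        ≡⟨ cong₂ ℚ._+_ (cong₂ ℚ._+_ (ℕ→ℚ-homo-* a b) (ℕ→ℚ-homo-* b c)) (ℕ→ℚ-homo-* c a) ⟨
      ℕ→ℚ (a * b) ℚ.+ ℕ→ℚ (b * c) ℚ.+ ℕ→ℚ (c * a)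
        ≡⟨ cong₂ ℚ._+_ (ℕ→ℚ-homo-+ (a * b) (b * c)) refl ⟨
      ℕ→ℚ (a * b + b * c) ℚ.+ ℕ→ℚ (c * a)
        ≡⟨ ℕ→ℚ-homo-+ (a * b + b * c) (c * a) ⟨
      ℕ→ℚ (a * b + b * c + c * a)
        ≡⟨ cong ℕ→ℚ (trans ab+bc+ca≡q*b*b (sym (ℕ.*-assoc q b b))) ⟩
      ℕ→ℚ (q * b * b)
        ≡⟨ trans (ℕ→ℚ-homo-* (q * b) b) (cong (ℚ._* B) (ℕ→ℚ-homo-* q b)) ⟩
      Q ℚ.* B ℚ.* B
        ∎

    lensα≡q-1 : lensα A B C ≡ Q ℚ.- 1ℚ
    lensα≡q-1 = begin
      (A ℚ.* B ℚ.+ B ℚ.* C ℚ.+ C ℚ.* A) ÷ B ÷ B ℚ.- 1ℚ  ≡⟨ cong (λ x → x ÷ B ÷ B ℚ.- 1ℚ) numerator ⟩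
      Q ℚ.* B ℚ.* B ÷ B ÷ B ℚ.- 1ℚ                      ≡⟨ cong (λ x → x ÷ B ℚ.- 1ℚ) (*-÷-cancel (Q ℚ.* B) B) ⟩
      Q ℚ.* B ÷ B ℚ.- 1ℚ                                ≡⟨ cong (ℚ._- 1ℚ) (*-÷-cancel Q B) ⟩
      Q ℚ.- 1ℚ                                          ∎

  lensβ-integral : b ∣ a * c → IsIntegral (lensβ A B C)
  lensβ-integral (divides r ac≡r*b) =
    subst IsIntegral (sym lensβ≡b-r) (-integral (ℕ→ℚ-integral b) (ℕ→ℚ-integral r))
    where
    open ≡-Reasoning
    R = ℕ→ℚ r

    lensβ≡b-r : lensβ A B C ≡ B ℚ.- R
    lensβ≡b-r = begin
      (B ℚ.* B ℚ.- A ℚ.* C) ÷ B  ≡⟨ cong (λ x → (B ℚ.* B ℚ.- x) ÷ B) A*C≡R*B ⟩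
      (B ℚ.* B ℚ.- R ℚ.* B) ÷ B  ≡⟨ cong (_÷ B) (solve 2 (λ b r → b :* b :- r :* b := (b :- r) :* b) refl B R) ⟩
      (B ℚ.- R) ℚ.* B ÷ B        ≡⟨ *-÷-cancel (B ℚ.- R) B ⟩
      B ℚ.- R                    ∎
      where
      open +-*-Solver
      A*C≡R*B : A ℚ.* C ≡ R ℚ.* B
      A*C≡R*B = trans (sym (ℕ→ℚ-homo-* a c)) (trans (cong ℕ→ℚ ac≡r*b) (ℕ→ℚ-homo-* r b))

proposition4p2 : (a b c : ℕ) → .{{_ : NonZero a}} → .{{_ : NonZero b}} → .{{_ : NonZero c}} →
    b ∣ a * c → (b * b) ∣ (a * b + b * c + c * a) →
    (s : ℤ → ℚ) → IsLensSequence (ℕ→ℚ a) (ℕ→ℚ b) (ℕ→ℚ c) s →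
    (n : ℤ) → ∃ λ (k : ℤ) → s n ≡ k / 1
proposition4p2 a b c b∣ac b²∣ab+bc+ca s (s₀≡a , s₁≡b , recurrence) =
  recurrence-integral (lensα-integral a b c b²∣ab+bc+ca) (lensβ-integral a b c b∣ac) s recurrence
    (subst IsIntegral (sym s₀≡a) (ℕ→ℚ-integral a))
    (subst IsIntegral (sym s₁≡b) (ℕ→ℚ-integral b))
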